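{- If $N\in\{1,2,4,5,7,8,10,13,16\}$, there does not exist an antipodal $5$-design with $2N$ rational points for the Chebyshev measure $(1-t^2)^{ -1/2}dt/\pi$ on $(-1,1)$.
   Context: An $m$-design with $n$ points for a probability measure $w(t)dt$ on an interval $I$ is a set of $n$ pairwise distinct points $x_1,\dots,x_n\in I$ with $\frac1n\sum_i f(x_i)=\int_I f(t)w(t)dt$ for every real polynomial $f$ of degree at most $m$. It is rational if all $x_i\in\mathbb{Q}$ and antipodal if $\{x_i\}=\{ -x_i\}$. -}

module Defs where

open import Data.Nat as ℕ using (ℕ; zero; suc)
open import Data.Nat.Properties using (m^n≢0)
open import Data.Nat.DivMod using (_%_) renaming (_/_ to _div_)
open import Data.Nat.Combinatorics using (_C_)
open import Data.Integer using (+_)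
open import Data.Rational using (ℚ; 0ℚ; 1ℚ; _+_; _*_; -_; _<_; _/_)
open import Data.Fin using (Fin; zero; suc)
open import Data.List using (List; []; _∷_; length)
open import Data.Product using (_×_; ∃-syntax)
open import Relation.Binary.PropositionalEquality using (_≡_)
open import Function.Definitions using (Injective)

sumFin : ∀ {n} → (Fin n → ℚ) → ℚ
sumFin {zero} f = 0ℚ
sumFin {suc n} f = f zero + sumFin (λ i → f (suc i))

-- Polynomials: coefficient lists c₀ ∷ c₁ ∷ … (c₀ + c₁ t + c₂ t² + …).
-- A list of length ≤ m+1 represents a polynomial of degree ≤ m.
Poly : Set
Poly = List ℚ

eval : Poly → ℚ → ℚ
eval [] x = 0ℚ
eval (c ∷ cs) x = c + x * eval cs x

-- Even moment of the Chebyshev measure (1-t²)^{-1/2} dt/π on (-1,1):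
-- ∫ t^{2j} dμ = C(2j,j) / 4^j.
evenMoment : ℕ → ℚ
evenMoment j = (+ ((2 ℕ.* j) C j) / (4 ℕ.^ j)) {{m^n≢0 4 j}}

chebMoment : ℕ → ℚ
chebMoment k with k % 2
... | zero = evenMoment (k div 2)
... | suc _ = 0ℚ

integAux : ℕ → Poly → ℚ
integAux k [] = 0ℚ
integAux k (c ∷ cs) = c * chebMoment k + integAux (suc k) cs

chebIntegral : Poly → ℚ
chebIntegral = integAux 0

-- A rational m-design with n points for the Chebyshev measure on (-1,1):
-- n pairwise distinct rational points in (-1,1) such that
-- (1/n) Σ f(xᵢ) = ∫ f dμ for all polynomials f of degree ≤ m
-- (written multiplied through by n).
IsChebDesign : (m n : ℕ) → (Fin n → ℚ) → Set
IsChebDesign m n x =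
  Injective _≡_ _≡_ x
  × (∀ i → (- 1ℚ < x i) × (x i < 1ℚ))
  × (∀ (f : Poly) → length f ℕ.≤ suc m →
       sumFin (λ i → eval f (x i)) ≡ (+ n / 1) * chebIntegral f)

IsAntipodal : ∀ {n} → (Fin n → ℚ) → Set
IsAntipodal {n} x = ∀ i → ∃[ j ] (x j ≡ - x i)

{-# OPTIONS --safe #-}
module Submission where

-- An antipodal design with 2N points is {±y : y ∈ P}, possibly together with 0, for a set P of at
-- most N positive rationals, and the Chebyshev moments ∫t² = 1/2 and ∫t⁴ = 3/8 give Σ_P y² = N/2
-- and Σ_P y⁴ = 3N/8. Scaling P by a common denominator D yields naturals aᵢ with 2 Σ aᵢ² = N D²
-- and 8 Σ aᵢ⁴ = 3 N D⁴, and no such solution has a least D. If c is the number of odd aᵢ, then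
-- Σ aᵢ⁴ ≡ c (mod 16) and Σ aᵢ² ≡ c (mod 4), so an odd D forces 32 ∣ N. For D = 2E we get
-- c ≡ 6 N E⁴ (mod 16), which for the listed N leaves c = 0, when halving all aᵢ and D gives a
-- smaller solution, or c = N = 16, which a⁴ + 1 ≡ 2 a² (mod 32) for odd a rules out.

module Congruence where

  open import Data.Nat using (ℕ; zero; suc; _+_; _*_; _^_; NonZero; >-nonZero⁻¹)
  open import Data.Nat.Properties using (_≟_; *-identityʳ)
  open import Data.Nat.DivMod
    using (_%_; m%n%n≡m%n; %-distribˡ-+; %-distribˡ-*; m%n<n; m<n⇒m%n≡m; m∣n⇒o%n%m≡o%m)
  open import Data.Nat.Divisibility using (_∣_; divides; m%n≡0⇒n∣m; n∣m⇒m%n≡0)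
  open import Data.Nat.ListAction using (sum)
  open import Data.Fin using (Fin; toℕ; fromℕ<)
  open import Data.Fin.Properties using (all?; toℕ-fromℕ<)
  open import Data.List using (map)
  open import Data.List.Relation.Unary.All using (All; []; _∷_)
  open import Level using (0ℓ)
  open import Relation.Binary.Bundles using (Setoid)
  open import Relation.Nullary.Decidable using (Dec; True; toWitness)
  open import Relation.Binary.PropositionalEquality
    using (_≡_; refl; sym; trans; cong; cong₂; subst; subst₂; module ≡-Reasoning)

  infix 4 _≡_mod_

  -- A record rather than a function into _≡_, so that a and b can be inferred from the type.
  record _≡_mod_ (a b m : ℕ) .{{_ : NonZero m}} : Set where
    constructor congruent
    field
      %-≡ : a % m ≡ b % m

  open _≡_mod_ public

  module _ {m : ℕ} .{{_ : NonZero m}} where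

    ≡-mod-refl : ∀ {a} → a ≡ a mod m
    ≡-mod-refl = congruent refl

    ≡-mod-sym : ∀ {a b} → a ≡ b mod m → b ≡ a mod m
    ≡-mod-sym (congruent e) = congruent (sym e)

    ≡-mod-trans : ∀ {a b c} → a ≡ b mod m → b ≡ c mod m → a ≡ c mod m
    ≡-mod-trans (congruent e) (congruent f) = congruent (trans e f)

  ≡-mod-setoid : (m : ℕ) .{{_ : NonZero m}} → Setoid 0ℓ 0ℓ
  ≡-mod-setoid m = record
    { Carrier       = ℕ
    ; _≈_           = λ a b → a ≡ b mod m
    ; isEquivalence = record { refl = ≡-mod-refl ; sym = ≡-mod-sym ; trans = ≡-mod-trans }
    }

  module ≡-mod-Reasoning (m : ℕ) .{{_ : NonZero m}} where
    open import Relation.Binary.Reasoning.Setoid (≡-mod-setoid m) public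

  module _ {m : ℕ} .{{_ : NonZero m}} where

    0%m≡0 : 0 % m ≡ 0
    0%m≡0 = m<n⇒m%n≡m (>-nonZero⁻¹ m)

    %-≡-mod : ∀ a → a % m ≡ a mod m
    %-≡-mod a = congruent (m%n%n≡m%n a m)

    +-cong-mod : ∀ {a b c d} → a ≡ b mod m → c ≡ d mod m → a + c ≡ b + d mod m
    +-cong-mod {a} {b} {c} {d} (congruent a≡b) (congruent c≡d) = congruent (begin
      (a + c) % m             ≡⟨ %-distribˡ-+ a c m ⟩
      (a % m + c % m) % m     ≡⟨ cong₂ (λ x y → (x + y) % m) a≡b c≡d ⟩
      (b % m + d % m) % m     ≡⟨ %-distribˡ-+ b d m ⟨
      (b + d) % m             ∎)
      where open ≡-Reasoning

    *-cong-mod : ∀ {a b c d} → a ≡ b mod m → c ≡ d mod m → a * c ≡ b * d mod m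
    *-cong-mod {a} {b} {c} {d} (congruent a≡b) (congruent c≡d) = congruent (begin
      (a * c) % m             ≡⟨ %-distribˡ-* a c m ⟩
      (a % m * (c % m)) % m   ≡⟨ cong₂ (λ x y → (x * y) % m) a≡b c≡d ⟩
      (b % m * (d % m)) % m   ≡⟨ %-distribˡ-* b d m ⟨
      (b * d) % m             ∎)
      where open ≡-Reasoning

    ^-cong-mod : ∀ {a b} k → a ≡ b mod m → a ^ k ≡ b ^ k mod m
    ^-cong-mod zero    a≡b = ≡-mod-refl
    ^-cong-mod (suc k) a≡b = *-cong-mod a≡b (^-cong-mod k a≡b)

    ≡-mod-∣ : ∀ {a b} d .{{_ : NonZero d}} → d ∣ m → a ≡ b mod m → a ≡ b mod d
    ≡-mod-∣ {a} {b} d d∣m (congruent a≡b) = congruent (begin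
      a % d        ≡⟨ m∣n⇒o%n%m≡o%m d m a d∣m ⟨
      a % m % d    ≡⟨ cong (_% d) a≡b ⟩
      b % m % d    ≡⟨ m∣n⇒o%n%m≡o%m d m b d∣m ⟩
      b % d        ∎)
      where open ≡-Reasoning

    %-cong-mod : ∀ {a b} d .{{_ : NonZero d}} → d ∣ m → a ≡ b mod m → a % d ≡ b % d mod m
    %-cong-mod d d∣m a≡b = congruent (cong (_% m) (%-≡ (≡-mod-∣ d d∣m a≡b)))

    ∣⇒≡0-mod : ∀ {a} → m ∣ a → a ≡ 0 mod m
    ∣⇒≡0-mod {a} m∣a = congruent (trans (n∣m⇒m%n≡0 a m m∣a) (sym 0%m≡0))

    ≡0-mod⇒∣ : ∀ {a} → a ≡ 0 mod m → m ∣ a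
    ≡0-mod⇒∣ {a} (congruent a≡0) = m%n≡0⇒n∣m a m (trans a≡0 0%m≡0)

    sum-cong-mod : ∀ {f g : ℕ → ℕ} {as} → All (λ a → f a ≡ g a mod m) as →
                   sum (map f as) ≡ sum (map g as) mod m
    sum-cong-mod []                = ≡-mod-refl
    sum-cong-mod (fa≡ga ∷ fas≡gas) = +-cong-mod fa≡ga (sum-cong-mod fas≡gas)

    Respects-mod : (ℕ → ℕ) → Set
    Respects-mod f = ∀ {a b} → a ≡ b mod m → f a ≡ f b mod m

    residues? : (f g : ℕ → ℕ) → Dec (∀ (r : Fin m) → f (toℕ r) % m ≡ g (toℕ r) % m)
    residues? f g = all? (λ r → f (toℕ r) % m ≟ g (toℕ r) % m)

    by-residues : (f g : ℕ → ℕ) → Respects-mod f → Respects-mod g →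
                  {_ : True (residues? f g)} → ∀ a → f a ≡ g a mod m
    by-residues f g f-resp g-resp {check} a =
      ≡-mod-trans (≡-mod-sym (f-resp (%-≡-mod a))) (≡-mod-trans residue (g-resp (%-≡-mod a)))
      where
      a<m = m%n<n a m
      residue : f (a % m) ≡ g (a % m) mod m
      residue = congruent (subst (λ r → f r % m ≡ g r % m) (toℕ-fromℕ< a<m) (toWitness check (fromℕ< a<m)))

  ^4≡%2[mod16] : ∀ a → a ^ 4 ≡ a % 2 mod 16
  ^4≡%2[mod16] = by-residues (_^ 4) (_% 2) (^-cong-mod 4) (%-cong-mod 2 (divides 8 refl))

  ^2≡%2[mod4] : ∀ a → a ^ 2 ≡ a % 2 mod 4
  ^2≡%2[mod4] = by-residues (_^ 2) (_% 2) (^-cong-mod 2) (%-cong-mod 2 (divides 2 refl))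

  odd⇒^4≡1[mod16] : ∀ {a} → a % 2 ≡ 1 → a ^ 4 ≡ 1 mod 16
  odd⇒^4≡1[mod16] {a} odd = ≡-mod-trans (^4≡%2[mod16] a) (congruent (cong (_% 16) odd))

  odd⇒^4+1≡2*^2[mod32] : ∀ {a} → a % 2 ≡ 1 → a ^ 4 + 1 ≡ 2 * a ^ 2 mod 32
  odd⇒^4+1≡2*^2[mod32] {a} odd =
    subst₂ (λ x y → x ≡ y mod 32) (weight-1 (a ^ 4 + 1)) (weight-1 (2 * a ^ 2)) (weighted a)
    where
    -- by-residues needs a statement about every a; the factor a % 2 makes it trivial for even a.
    weighted : ∀ a → (a ^ 4 + 1) * (a % 2) ≡ 2 * a ^ 2 * (a % 2) mod 32
    weighted = by-residues (λ a → (a ^ 4 + 1) * (a % 2)) (λ a → 2 * a ^ 2 * (a % 2))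
      (λ h → *-cong-mod (+-cong-mod (^-cong-mod 4 h) ≡-mod-refl) (%-cong-mod 2 (divides 16 refl) h))
      (λ h → *-cong-mod (*-cong-mod (≡-mod-refl {a = 2}) (^-cong-mod 2 h)) (%-cong-mod 2 (divides 16 refl) h))
    weight-1 : ∀ x → x * (a % 2) ≡ x
    weight-1 x = trans (cong (x *_) odd) (*-identityʳ x)

module Descent where

  open Congruence
  open import Data.Nat using (ℕ; zero; suc; _+_; _*_; _^_; _≤_; _<_; z≤n; s≤s; >-nonZero)
  open import Data.Nat.Properties
  open import Data.Nat.DivMod using (_%_; _/_; m*[n/m]≡n; m%n<n; m%n≤m; [m+kn]%n≡m%n)
  open import Data.Nat.Divisibility
    using (_∣_; divides; quotient; m%n≡0⇒n∣m; ∣⇒≤; m∣m*n; *-monoˡ-∣)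
  open import Data.Nat.Coprimality using (coprime?; coprime-divisor)
  open import Data.Nat.ListAction using (sum)
  open import Data.Nat.Induction using (<-rec)
  open import Data.Nat.Tactic.RingSolver using (solve-∀)
  open import Algebra.Properties.CommutativeSemigroup *-commutativeSemigroup using (x∙yz≈y∙xz)
  open import Data.List using (List; []; _∷_; map; length)
  open import Data.List.Properties using (length-map; map-∘; map-cong)
  open import Data.List.Relation.Unary.All as All using (All; []; _∷_)
  open import Data.Product using (_×_; _,_; ∃-syntax)
  open import Data.Sum using (_⊎_; inj₁; inj₂)
  open import Data.Empty using (⊥)
  open import Relation.Nullary using (¬_; contradiction)
  open import Relation.Nullary.Decidable using (from-yes; _×-dec_; _⊎-dec_)
  open import Relation.Unary using (Decidable)
  open import Relation.Binary.PropositionalEquality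
    using (_≡_; refl; sym; trans; cong; cong₂; subst; module ≡-Reasoning)

  ^-distrib-* : ∀ a b k → (a * b) ^ k ≡ a ^ k * b ^ k
  ^-distrib-* a b zero    = refl
  ^-distrib-* a b (suc k) =
    trans (cong (a * b *_) (^-distrib-* a b k)) ([m*n]*[o*p]≡[m*o]*[n*p] a b (a ^ k) (b ^ k))

  sum-map-*ˡ : ∀ c (f : ℕ → ℕ) as → sum (map (λ a → c * f a) as) ≡ c * sum (map f as)
  sum-map-*ˡ c f []       = sym (*-zeroʳ c)
  sum-map-*ˡ c f (a ∷ as) = trans (cong (c * f a +_) (sum-map-*ˡ c f as)) (sym (*-distribˡ-+ c (f a) _))

  sum-map-+1 : ∀ (f : ℕ → ℕ) as → sum (map (λ a → f a + 1) as) ≡ sum (map f as) + length as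
  sum-map-+1 f []       = refl
  sum-map-+1 f (a ∷ as) = trans (cong (f a + 1 +_) (sum-map-+1 f as)) (regroup (f a) _ _)
    where
    regroup : ∀ x s n → x + 1 + (s + n) ≡ x + s + suc n
    regroup = solve-∀

  %2≤1 : ∀ a → a % 2 ≤ 1
  %2≤1 a = ≤-pred (m%n<n a 2)

  even-or-odd : ∀ n → (∃[ k ] n ≡ 2 * k) ⊎ n % 2 ≡ 1
  even-or-odd n with n % 2 in r | %2≤1 n
  ... | 0           | _      = inj₁ (n / 2 , sym (m*[n/m]≡n (m%n≡0⇒n∣m n 2 r)))
  ... | 1           | _      = inj₂ refl
  ... | suc (suc _) | s≤s ()

  double-half : ∀ {as} → All (λ a → a % 2 ≡ 0) as → map (2 *_) (map (_/ 2) as) ≡ as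
  double-half []               = refl
  double-half {a ∷ _} (e ∷ es) = cong₂ _∷_ (m*[n/m]≡n (m%n≡0⇒n∣m a 2 e)) (double-half es)

  powerSum : ℕ → List ℕ → ℕ
  powerSum k as = sum (map (_^ k) as)

  powerSum-scale : ∀ c k as → powerSum k (map (c *_) as) ≡ c ^ k * powerSum k as
  powerSum-scale c k as = begin
    sum (map (_^ k) (map (c *_) as))    ≡⟨ cong sum (map-∘ as) ⟨
    sum (map (λ a → (c * a) ^ k) as)    ≡⟨ cong sum (map-cong (λ a → ^-distrib-* c a k) as) ⟩
    sum (map (λ a → c ^ k * a ^ k) as)  ≡⟨ sum-map-*ˡ (c ^ k) (_^ k) as ⟩
    c ^ k * powerSum k as               ∎
    where open ≡-Reasoning

  oddCount : List ℕ → ℕ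
  oddCount as = sum (map (_% 2) as)

  oddCount≤length : ∀ as → oddCount as ≤ length as
  oddCount≤length []       = z≤n
  oddCount≤length (a ∷ as) = +-mono-≤ (%2≤1 a) (oddCount≤length as)

  oddCount≡0⇒even : ∀ as → oddCount as ≡ 0 → All (λ a → a % 2 ≡ 0) as
  oddCount≡0⇒even []       _   = []
  oddCount≡0⇒even (a ∷ as) c≡0 =
    m+n≡0⇒m≡0 (a % 2) c≡0 ∷ oddCount≡0⇒even as (m+n≡0⇒n≡0 (a % 2) c≡0)

  oddCount≡length⇒odd : ∀ as → oddCount as ≡ length as → All (λ a → a % 2 ≡ 1) as
  oddCount≡length⇒odd []       _ = []
  oddCount≡length⇒odd (a ∷ as) c≡len with a % 2 in odd | %2≤1 a
  ... | 0           | _      = contradiction (subst (_≤ length as) c≡len (oddCount≤length as)) (<⇒≱ (n<1+n _))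
  ... | 1           | _      = odd ∷ oddCount≡length⇒odd as (suc-injective c≡len)
  ... | suc (suc _) | s≤s ()

  powerSum≡oddCount[mod16] : ∀ as → powerSum 4 as ≡ oddCount as mod 16
  powerSum≡oddCount[mod16] as = sum-cong-mod (All.universal ^4≡%2[mod16] as)

  powerSum≡oddCount[mod4] : ∀ as → powerSum 2 as ≡ oddCount as mod 4
  powerSum≡oddCount[mod4] as = sum-cong-mod (All.universal ^2≡%2[mod4] as)

  odd-powerSums[mod32] : ∀ {as} → All (λ a → a % 2 ≡ 1) as →
                         powerSum 4 as + length as ≡ 2 * powerSum 2 as mod 32
  odd-powerSums[mod32] {as} odds = begin
    powerSum 4 as + length as        ≡⟨ sum-map-+1 (_^ 4) as ⟨
    sum (map (λ a → a ^ 4 + 1) as)   ≈⟨ sum-cong-mod (All.map (λ {a} → odd⇒^4+1≡2*^2[mod32] {a}) odds) ⟩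
    sum (map (λ a → 2 * a ^ 2) as)   ≡⟨ sum-map-*ˡ 2 (_^ 2) as ⟩
    2 * powerSum 2 as                ∎
    where open ≡-mod-Reasoning 32

  -- as lists the positive points of an antipodal design with 2N points, multiplied by D.
  record ScaledHalfDesign (N D : ℕ) (as : List ℕ) : Set where
    field
      length≤  : length as ≤ N
      squares  : 2 * powerSum 2 as ≡ N * D ^ 2
      quartics : 8 * powerSum 4 as ≡ 3 * N * D ^ 4

  odd-denominator⇒8∣N : ∀ {N D as} → D % 2 ≡ 1 → ScaledHalfDesign N D as → 8 ∣ N
  odd-denominator⇒8∣N {N} {D} {as} odd sol =
    coprime-divisor (from-yes (coprime? 8 3)) (≡0-mod⇒∣ (begin
      3 * N              ≡⟨ *-identityʳ (3 * N) ⟨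
      3 * N * 1          ≈⟨ *-cong-mod (≡-mod-refl {a = 3 * N}) (≡-mod-sym D⁴≡1) ⟩
      3 * N * D ^ 4      ≡⟨ ScaledHalfDesign.quartics sol ⟨
      8 * powerSum 4 as  ≈⟨ ∣⇒≡0-mod (m∣m*n (powerSum 4 as)) ⟩
      0                  ∎))
    where
    open ≡-mod-Reasoning 8
    D⁴≡1 = ≡-mod-∣ 8 (divides 2 refl) (odd⇒^4≡1[mod16] {D} odd)

  odd-denominator⇒32∣N : ∀ {N D as} → D % 2 ≡ 1 → ScaledHalfDesign N D as → 32 ∣ N
  odd-denominator⇒32∣N {N} {D} {as} odd sol = subst (32 ∣_) (sym N≡k*8) (*-monoˡ-∣ 8 4∣k)
    where
    open ScaledHalfDesign sol
    8∣N = odd-denominator⇒8∣N odd sol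
    k = quotient 8∣N
    N≡k*8 : N ≡ k * 8
    N≡k*8 = _∣_.equality 8∣N
    D⁴≡1 = ≡-mod-∣ 4 (divides 4 refl) (odd⇒^4≡1[mod16] {D} odd)
    squares′ : powerSum 2 as ≡ 4 * (k * D ^ 2)
    squares′ = *-cancelˡ-≡ _ _ 2 (trans squares (trans (cong (_* D ^ 2) N≡k*8) (regroup k (D ^ 2))))
      where
      regroup : ∀ k x → k * 8 * x ≡ 2 * (4 * (k * x))
      regroup = solve-∀
    quartics′ : powerSum 4 as ≡ 3 * k * D ^ 4
    quartics′ =
      *-cancelˡ-≡ _ _ 8 (trans quartics (trans (cong (λ n → 3 * n * D ^ 4) N≡k*8) (regroup k (D ^ 4))))
      where
      regroup : ∀ k x → 3 * (k * 8) * x ≡ 8 * (3 * k * x)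
      regroup = solve-∀
    4∣k : 4 ∣ k
    4∣k = coprime-divisor (from-yes (coprime? 4 3)) (≡0-mod⇒∣ (begin
      3 * k              ≡⟨ *-identityʳ (3 * k) ⟨
      3 * k * 1          ≈⟨ *-cong-mod (≡-mod-refl {a = 3 * k}) (≡-mod-sym D⁴≡1) ⟩
      3 * k * D ^ 4      ≡⟨ quartics′ ⟨
      powerSum 4 as      ≈⟨ ≡-mod-∣ 4 (divides 4 refl) (powerSum≡oddCount[mod16] as) ⟩
      oddCount as        ≈⟨ powerSum≡oddCount[mod4] as ⟨
      powerSum 2 as      ≡⟨ squares′ ⟩
      4 * (k * D ^ 2)    ≈⟨ ∣⇒≡0-mod (m∣m*n (k * D ^ 2)) ⟩
      0                  ∎))
      where open ≡-mod-Reasoning 4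

  halve-numerators : ∀ {N E as} → ScaledHalfDesign N (2 * E) as → All (λ a → a % 2 ≡ 0) as →
                     ScaledHalfDesign N E (map (_/ 2) as)
  halve-numerators {N} {E} {as} sol evens = record
    { length≤  = subst (_≤ N) (sym (length-map (_/ 2) as)) length≤
    ; squares  = *-cancelˡ-≡ _ _ 4 (begin
        4 * (2 * powerSum 2 bs)     ≡⟨ x∙yz≈y∙xz 4 2 (powerSum 2 bs) ⟩
        2 * (2 ^ 2 * powerSum 2 bs) ≡⟨ cong (2 *_) (doubled 2) ⟩
        2 * powerSum 2 as           ≡⟨ squares ⟩
        N * (2 * E) ^ 2             ≡⟨ cong (N *_) (^-distrib-* 2 E 2) ⟩
        N * (2 ^ 2 * E ^ 2)         ≡⟨ x∙yz≈y∙xz N 4 (E ^ 2) ⟩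
        4 * (N * E ^ 2)             ∎)
    ; quartics = *-cancelˡ-≡ _ _ 16 (begin
        16 * (8 * powerSum 4 bs)    ≡⟨ x∙yz≈y∙xz 16 8 (powerSum 4 bs) ⟩
        8 * (2 ^ 4 * powerSum 4 bs) ≡⟨ cong (8 *_) (doubled 4) ⟩
        8 * powerSum 4 as           ≡⟨ quartics ⟩
        3 * N * (2 * E) ^ 4         ≡⟨ cong (3 * N *_) (^-distrib-* 2 E 4) ⟩
        3 * N * (2 ^ 4 * E ^ 4)     ≡⟨ x∙yz≈y∙xz (3 * N) 16 (E ^ 4) ⟩
        16 * (3 * N * E ^ 4)        ∎)
    }
    where
    open ScaledHalfDesign sol
    open ≡-Reasoning
    bs = map (_/ 2) as
    doubled : ∀ k → 2 ^ k * powerSum k bs ≡ powerSum k as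
    doubled k = trans (sym (powerSum-scale 2 k bs)) (cong (powerSum k) (double-half evens))

  module _ {N E as} (sol : ScaledHalfDesign N (2 * E) as) where
    open ScaledHalfDesign sol

    even-denominator-squares : powerSum 2 as ≡ 2 * N * E ^ 2
    even-denominator-squares = *-cancelˡ-≡ _ _ 2 (begin
      2 * powerSum 2 as     ≡⟨ squares ⟩
      N * (2 * E) ^ 2       ≡⟨ cong (N *_) (^-distrib-* 2 E 2) ⟩
      N * (2 ^ 2 * E ^ 2)   ≡⟨ regroup N (E ^ 2) ⟩
      2 * (2 * N * E ^ 2)   ∎)
      where
      open ≡-Reasoning
      regroup : ∀ n x → n * (4 * x) ≡ 2 * (2 * n * x)
      regroup = solve-∀

    even-denominator-quartics : powerSum 4 as ≡ 6 * N * E ^ 4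
    even-denominator-quartics = *-cancelˡ-≡ _ _ 8 (begin
      8 * powerSum 4 as       ≡⟨ quartics ⟩
      3 * N * (2 * E) ^ 4     ≡⟨ cong (3 * N *_) (^-distrib-* 2 E 4) ⟩
      3 * N * (2 ^ 4 * E ^ 4) ≡⟨ regroup N (E ^ 4) ⟩
      8 * (6 * N * E ^ 4)     ∎)
      where
      open ≡-Reasoning
      regroup : ∀ n x → 3 * n * (16 * x) ≡ 8 * (6 * n * x)
      regroup = solve-∀

    even-denominator-oddCount : oddCount as ≡ 6 * N * (E % 2) mod 16
    even-denominator-oddCount = begin
      oddCount as        ≈⟨ powerSum≡oddCount[mod16] as ⟨
      powerSum 4 as      ≡⟨ even-denominator-quartics ⟩
      6 * N * E ^ 4      ≈⟨ *-cong-mod (≡-mod-refl {a = 6 * N}) (^4≡%2[mod16] E) ⟩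
      6 * N * (E % 2)    ∎
      where open ≡-mod-Reasoning 16

  sixteen-odd-numerators : ∀ {E as} → ScaledHalfDesign 16 (2 * E) as →
                           All (λ a → a % 2 ≡ 1) as → length as ≡ 16 → ⊥
  sixteen-odd-numerators {E} {as} sol odds length≡16 = contradiction (%-≡ 16≡0) λ ()
    where
    16≡0 : 16 ≡ 0 mod 32
    16≡0 = begin
      16                          ≈⟨ congruent ([m+kn]%n≡m%n 16 (3 * E ^ 4) 32) ⟨
      16 + 3 * E ^ 4 * 32         ≡⟨ regroup (E ^ 4) ⟩
      6 * 16 * E ^ 4 + 16         ≡⟨ cong₂ _+_ (even-denominator-quartics {E = E} sol) length≡16 ⟨
      powerSum 4 as + length as   ≈⟨ odd-powerSums[mod32] odds ⟩
      2 * powerSum 2 as           ≡⟨ cong (2 *_) (even-denominator-squares {E = E} sol) ⟩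
      2 * (2 * 16 * E ^ 2)        ≈⟨ ∣⇒≡0-mod (divides (2 * E ^ 2) (regroup′ (E ^ 2))) ⟩
      0                           ∎
      where
      open ≡-mod-Reasoning 32
      regroup : ∀ x → 16 + 3 * x * 32 ≡ 6 * 16 * x + 16
      regroup = solve-∀
      regroup′ : ∀ x → 2 * (2 * 16 * x) ≡ 2 * x * 32
      regroup′ = solve-∀

  -- For 0 < N ≤ 16 this holds exactly for the N of the theorem; it says that no 0 < c ≤ N is
  -- ≡ 0 or ≡ 6 N (mod 16), except c = N = 16.
  Admissible : ℕ → Set
  Admissible N = 0 < N × N ≤ 16 × (6 * N % 16 ≡ 0 ⊎ N < 6 * N % 16)

  admissible? : Decidable Admissible
  admissible? N = 0 <? N ×-dec N ≤? 16 ×-dec (6 * N % 16 ≟ 0 ⊎-dec N <? 6 * N % 16)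

  admissible⇒¬32∣ : ∀ {N} → Admissible N → ¬ 32 ∣ N
  admissible⇒¬32∣ (N>0 , N≤16 , _) 32∣N =
    <⇒≱ (from-yes (16 <? 32)) (≤-trans (∣⇒≤ {{>-nonZero N>0}} 32∣N) N≤16)

  positive-multiple-of-16 : ∀ {N c} → N ≤ 16 → 0 < c → c ≤ N → c % 16 ≡ 0 → c ≡ 16 × N ≡ 16
  positive-multiple-of-16 N≤16 c>0 c≤N c%16≡0 =
    ≤-antisym (≤-trans c≤N N≤16) 16≤c , ≤-antisym N≤16 (≤-trans 16≤c c≤N)
    where
    16≤c = ∣⇒≤ {{>-nonZero c>0}} (m%n≡0⇒n∣m _ 16 c%16≡0)

  admissible-count⇒16 : ∀ {N c} → Admissible N → 0 < c → c ≤ N →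
                        c % 16 ≡ 0 ⊎ c % 16 ≡ 6 * N % 16 → c ≡ 16 × N ≡ 16
  admissible-count⇒16 (_ , N≤16 , _) c>0 c≤N (inj₁ c≡0) =
    positive-multiple-of-16 N≤16 c>0 c≤N c≡0
  admissible-count⇒16 (_ , N≤16 , inj₁ 6N≡0) c>0 c≤N (inj₂ c≡6N) =
    positive-multiple-of-16 N≤16 c>0 c≤N (trans c≡6N 6N≡0)
  admissible-count⇒16 {N} {c} (_ , _ , inj₂ N<6N) c>0 c≤N (inj₂ c≡6N) =
    contradiction c≤N (<⇒≱ (<-≤-trans (subst (N <_) (sym c≡6N) N<6N) (m%n≤m c 16)))

  parity-residue : ∀ {c n} e → e ≤ 1 → c ≡ n * e mod 16 → c % 16 ≡ 0 ⊎ c % 16 ≡ n % 16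
  parity-residue {n = n} 0 _ (congruent c≡0) = inj₁ (trans c≡0 (cong (_% 16) (*-zeroʳ n)))
  parity-residue {n = n} 1 _ (congruent c≡n) = inj₂ (trans c≡n (cong (_% 16) (*-identityʳ n)))
  parity-residue (suc (suc _)) (s≤s ()) _

  even-denominator⇒oddCount≡0 : ∀ {N E as} → Admissible N → ScaledHalfDesign N (2 * E) as →
                                oddCount as ≡ 0
  even-denominator⇒oddCount≡0 {N} {E} {as} adm sol =
    n≤0⇒n≡0 (≮⇒≥ λ c>0 → sixteen (admissible-count⇒16 adm c>0 c≤N residue))
    where
    open ScaledHalfDesign sol
    c≤N = ≤-trans (oddCount≤length as) length≤
    residue = parity-residue {n = 6 * N} (E % 2) (%2≤1 E) (even-denominator-oddCount {E = E} sol)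
    sixteen : oddCount as ≡ 16 × N ≡ 16 → ⊥
    sixteen (c≡16 , N≡16) = sixteen-odd-numerators {E = E} sol′ odds length≡16
      where
      sol′ = subst (λ n → ScaledHalfDesign n (2 * E) as) N≡16 sol
      length≡16 = ≤-antisym (subst (length as ≤_) N≡16 length≤) (subst (_≤ length as) c≡16 (oddCount≤length as))
      odds = oddCount≡length⇒odd as (trans c≡16 (sym length≡16))

  no-scaled-half-design : ∀ {N} → Admissible N → ∀ D → 0 < D → ∀ as → ¬ ScaledHalfDesign N D as
  no-scaled-half-design {N} adm = <-rec (λ D → 0 < D → ∀ as → ¬ ScaledHalfDesign N D as) descent
    where
    descent : ∀ D → (∀ {E} → E < D → 0 < E → ∀ bs → ¬ ScaledHalfDesign N E bs) →
              0 < D → ∀ as → ¬ ScaledHalfDesign N D as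
    descent D smaller D>0 as sol with even-or-odd D
    ... | inj₂ odd        = admissible⇒¬32∣ adm (odd-denominator⇒32∣N odd sol)
    ... | inj₁ (E , refl) = smaller E<2E E>0 (map (_/ 2) as) (halve-numerators {E = E} sol evens)
      where
      evens = oddCount≡0⇒even as (even-denominator⇒oddCount≡0 {E = E} adm sol)
      E>0 = *-cancelˡ-< 2 0 E D>0
      E<2E = subst (E <_) (*-comm E 2) (m<m*n E 2 {{>-nonZero E>0}} (s≤s (s≤s z≤n)))

module Rational where

  open import Defs
  open Descent using (powerSum; ScaledHalfDesign)
  open import Data.Nat as ℕ using (ℕ; zero; suc; s≤s; z≤n)
  import Data.Nat.Properties as ℕ
  import Data.Nat.Coprimality as Coprime
  open import Data.Nat.DivMod using (m*[n/m]≡n)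
  open import Data.Nat.ListAction using (product)
  open import Data.Nat.ListAction.Properties using (product≢0; ∈⇒∣product)
  open import Data.Nat.Tactic.RingSolver using (solve-∀)
  import Data.Integer as ℤ
  import Data.Integer.Properties as ℤ
  open import Data.Rational using (ℚ; mkℚ; _+_; _*_; -_; 0ℚ; 1ℚ; _/_; ↥_; ↧ₙ_; _<_; _≤_; *≤*)
  open import Data.Rational.Properties as ℚ
    using (toℚᵘ-injective; toℚᵘ-homo-+; toℚᵘ-homo-*; normalize-coprime; _≟_; _<?_)
  import Data.Rational.Unnormalised as ℚᵘ
  import Data.Rational.Unnormalised.Properties as ℚᵘ
  open import Data.Rational.Solver using (module +-*-Solver)
  open +-*-Solver using (solve; _:+_; _:*_; _:^_; :-_; _:=_; con)
  open import Algebra.Bundles using (CommutativeRing; CommutativeMonoid)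
  open import Algebra.Properties.CommutativeSemiring.Exp
    (CommutativeRing.commutativeSemiring ℚ.+-*-commutativeRing) using (_^_; ^-distrib-*)
  open import Algebra.Properties.CommutativeSemigroup
    (CommutativeMonoid.commutativeSemigroup ℚ.*-1-commutativeMonoid) using (x∙yz≈yx∙z)
  open import Algebra.Properties.Group ℚ.+-0-group using () renaming (⁻¹-involutive to neg-involutive)
  open import Data.Fin using (Fin; zero; suc)
  open import Data.List using (List; []; _∷_; _++_; map; foldr; filter; tabulate; length)
  open import Data.List.Properties
    using (length-tabulate; map-tabulate; map-cong; map-∘; map-++; length-map; length-++; length-++-≤ʳ)
  open import Data.List.Relation.Unary.All as All using (All; []; _∷_)
  open import Data.List.Relation.Unary.All.Properties as All using (all-filter)
  open import Data.List.Relation.Unary.Unique.Propositional using (Unique)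
  open import Data.List.Relation.Unary.Unique.Propositional.Properties using (++⁺; map⁺; filter⁺; tabulate⁺)
  open import Data.List.Relation.Binary.Disjoint.Propositional using (Disjoint)
  open import Data.List.Relation.Binary.Permutation.Propositional using (_↭_; ↭⇒↭ₛ)
  open import Data.List.Relation.Binary.Permutation.Propositional.Properties
    using (↭-length) renaming (map⁺ to ↭-map⁺)
  open import Data.List.Relation.Binary.Permutation.Setoid.Properties using (foldr-commMonoid)
  open import Data.List.Relation.Binary.BagAndSetEquality using (∼bag⇒↭)
  open import Data.List.Membership.Propositional using (_∈_)
  open import Data.List.Membership.Propositional.Properties
    using (∈-tabulate⁺; ∈-tabulate⁻; ∈-filter⁺; ∈-filter⁻; ∈-++⁺ˡ; ∈-++⁺ʳ; ∈-++⁻; ∈-map⁺; ∈-map⁻)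
  open import Data.List.Membership.Propositional.Properties.WithK using (unique∧set⇒bag)
  open import Data.Product using (_×_; _,_; proj₁; proj₂; ∃-syntax)
  open import Data.Sum using (inj₁; inj₂)
  open import Function using (_∘_)
  open import Function.Bundles using (_⇔_; mk⇔)
  open import Relation.Binary.Definitions using (tri<; tri≈; tri>)
  open import Relation.Binary.PropositionalEquality
    using (_≡_; refl; sym; trans; cong; cong₂; subst; subst₂; module ≡-Reasoning)

  fromℕ : ℕ → ℚ
  fromℕ n = mkℚ (ℤ.+ n) 0 (Coprime.sym (Coprime.1-coprimeTo n))

  n/1≡fromℕ : ∀ n → ℤ.+ n / 1 ≡ fromℕ n
  n/1≡fromℕ n = normalize-coprime (Coprime.sym (Coprime.1-coprimeTo n))

  fromℕ-+ : ∀ m n → fromℕ (m ℕ.+ n) ≡ fromℕ m + fromℕ n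
  fromℕ-+ m n = toℚᵘ-injective (ℚᵘ.≃-sym (ℚᵘ.≃-trans (toℚᵘ-homo-+ (fromℕ m) (fromℕ n)) (ℚᵘ.*≡* cross)))
    where
    cross : (ℤ.+ m ℤ.* ℤ.+ 1 ℤ.+ ℤ.+ n ℤ.* ℤ.+ 1) ℤ.* ℤ.+ 1 ≡ ℤ.+ (m ℕ.+ n) ℤ.* ℤ.+ 1
    cross = cong (ℤ._* ℤ.+ 1)
      (trans (cong₂ ℤ._+_ (ℤ.*-identityʳ (ℤ.+ m)) (ℤ.*-identityʳ (ℤ.+ n))) (sym (ℤ.pos-+ m n)))

  fromℕ-* : ∀ m n → fromℕ (m ℕ.* n) ≡ fromℕ m * fromℕ n
  fromℕ-* m n = toℚᵘ-injective (ℚᵘ.≃-sym (ℚᵘ.≃-trans (toℚᵘ-homo-* (fromℕ m) (fromℕ n)) (ℚᵘ.*≡* cross)))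
    where
    cross : (ℤ.+ m ℤ.* ℤ.+ n) ℤ.* ℤ.+ 1 ≡ ℤ.+ (m ℕ.* n) ℤ.* ℤ.+ 1
    cross = cong (ℤ._* ℤ.+ 1) (sym (ℤ.pos-* m n))

  fromℕ-^ : ∀ m k → fromℕ (m ℕ.^ k) ≡ fromℕ m ^ k
  fromℕ-^ m zero    = refl
  fromℕ-^ m (suc k) = trans (fromℕ-* m (m ℕ.^ k)) (cong (fromℕ m *_) (fromℕ-^ m k))

  fromℕ-injective : ∀ {m n} → fromℕ m ≡ fromℕ n → m ≡ n
  fromℕ-injective eq = ℤ.+-injective (cong ↥_ eq)

  sumℚ : List ℚ → ℚ
  sumℚ = foldr _+_ 0ℚ

  sumℚ-++ : ∀ xs ys → sumℚ (xs ++ ys) ≡ sumℚ xs + sumℚ ys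
  sumℚ-++ []       ys = sym (ℚ.+-identityˡ (sumℚ ys))
  sumℚ-++ (x ∷ xs) ys = trans (cong (x +_) (sumℚ-++ xs ys)) (sym (ℚ.+-assoc x (sumℚ xs) (sumℚ ys)))

  sumℚ-↭ : ∀ {xs ys} → xs ↭ ys → sumℚ xs ≡ sumℚ ys
  sumℚ-↭ p = foldr-commMonoid ℚ-+-0.setoid ℚ-+-0.isCommutativeMonoid (↭⇒↭ₛ p)
    where module ℚ-+-0 = CommutativeMonoid ℚ.+-0-commutativeMonoid

  sumFin-tabulate : ∀ {n} (f : Fin n → ℚ) → sumFin f ≡ sumℚ (tabulate f)
  sumFin-tabulate {zero}  f = refl
  sumFin-tabulate {suc n} f = cong (f zero +_) (sumFin-tabulate (f ∘ suc))

  powerSum-scaling : ∀ {c} {f : ℚ → ℕ} {ys} → All (λ y → y * c ≡ fromℕ (f y)) ys →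
                     ∀ k → sumℚ (map (_^ k) ys) * c ^ k ≡ fromℕ (powerSum k (map f ys))
  powerSum-scaling {c} []                           k = ℚ.*-zeroˡ (c ^ k)
  powerSum-scaling {c} {f} {y ∷ ys} (yc≡fy ∷ yscs≡fys) k = begin
    (y ^ k + sumℚ (map (_^ k) ys)) * c ^ k          ≡⟨ ℚ.*-distribʳ-+ (c ^ k) (y ^ k) _ ⟩
    y ^ k * c ^ k + sumℚ (map (_^ k) ys) * c ^ k
                                                    ≡⟨ cong₂ _+_ (sym (^-distrib-* y c k)) (powerSum-scaling yscs≡fys k) ⟩
    (y * c) ^ k + fromℕ rest                        ≡⟨ cong (λ z → z ^ k + fromℕ rest) yc≡fy ⟩
    fromℕ (f y) ^ k + fromℕ rest                    ≡⟨ cong (_+ fromℕ rest) (fromℕ-^ (f y) k) ⟨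
    fromℕ (f y ℕ.^ k) + fromℕ rest                  ≡⟨ fromℕ-+ (f y ℕ.^ k) rest ⟨
    fromℕ (powerSum k (map f (y ∷ ys)))             ∎
    where
    open ≡-Reasoning
    rest = powerSum k (map f ys)

  design-moments : ∀ {m n x} → IsChebDesign m n x → 4 ℕ.≤ m →
                   sumℚ (map (_^ 2) (tabulate x)) * fromℕ 2 ≡ fromℕ n ×
                   sumℚ (map (_^ 4) (tabulate x)) * fromℕ 8 ≡ fromℕ (3 ℕ.* n)
  design-moments {m} {n} {x} (_ , _ , exact) 4≤m =
    trans (moment square 2 2 1 eval-square (ℕ.≤-trans (s≤s (s≤s (s≤s z≤n))) (s≤s 4≤m)) refl)
          (cong fromℕ (ℕ.*-identityʳ n)) ,
    trans (moment quartic 4 8 3 eval-quartic (s≤s 4≤m) refl) (cong fromℕ (ℕ.*-comm n 3))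
    where
    square quartic : Poly
    square  = 0ℚ ∷ 0ℚ ∷ 1ℚ ∷ []
    quartic = 0ℚ ∷ 0ℚ ∷ 0ℚ ∷ 0ℚ ∷ 1ℚ ∷ []
    eval-square : ∀ t → eval square t ≡ t ^ 2
    eval-square = solve 1 (λ t → con 0ℚ :+ t :* (con 0ℚ :+ t :* (con 1ℚ :+ t :* con 0ℚ)) := t :^ 2) refl
    eval-quartic : ∀ t → eval quartic t ≡ t ^ 4
    eval-quartic = solve 1 (λ t →
      con 0ℚ :+ t :* (con 0ℚ :+ t :* (con 0ℚ :+ t :* (con 0ℚ :+ t :* (con 1ℚ :+ t :* con 0ℚ)))) := t :^ 4) refl
    moment : ∀ f k c r → (∀ t → eval f t ≡ t ^ k) → length f ℕ.≤ suc m →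
             chebIntegral f * fromℕ c ≡ fromℕ r → sumℚ (map (_^ k) (tabulate x)) * fromℕ c ≡ fromℕ (n ℕ.* r)
    moment f k c r eval-f f≤m integral = begin
      sumℚ (map (_^ k) (tabulate x)) * fromℕ c    ≡⟨ cong (λ s → sumℚ s * fromℕ c) (map-cong (sym ∘ eval-f) (tabulate x)) ⟩
      sumℚ (map (eval f) (tabulate x)) * fromℕ c  ≡⟨ cong (λ s → sumℚ s * fromℕ c) (map-tabulate x (eval f)) ⟩
      sumℚ (tabulate (eval f ∘ x)) * fromℕ c      ≡⟨ cong (_* fromℕ c) (sumFin-tabulate (eval f ∘ x)) ⟨
      sumFin (eval f ∘ x) * fromℕ c               ≡⟨ cong (_* fromℕ c) (exact f f≤m) ⟩
      ℤ.+ n / 1 * chebIntegral f * fromℕ c        ≡⟨ cong (λ q → q * chebIntegral f * fromℕ c) (n/1≡fromℕ n) ⟩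
      fromℕ n * chebIntegral f * fromℕ c          ≡⟨ ℚ.*-assoc (fromℕ n) (chebIntegral f) (fromℕ c) ⟩
      fromℕ n * (chebIntegral f * fromℕ c)        ≡⟨ cong (fromℕ n *_) integral ⟩
      fromℕ n * fromℕ r                           ≡⟨ fromℕ-* n r ⟨
      fromℕ (n ℕ.* r)                             ∎
      where open ≡-Reasoning

  module AntipodalSplit (L : List ℚ) (L-unique : Unique L) (closed : ∀ {y} → y ∈ L → - y ∈ L) where

    zeros positives : List ℚ
    zeros     = filter (_≟ 0ℚ) L
    positives = filter (0ℚ <?_) L

    positive : ∀ {y} → y ∈ positives → 0ℚ < y
    positive = proj₂ ∘ ∈-filter⁻ (0ℚ <?_) {xs = L}

    negative : ∀ {y} → y ∈ map -_ positives → y < 0ℚ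
    negative y∈-P with ∈-map⁻ -_ y∈-P
    ... | p , p∈P , refl = ℚ.neg-antimono-< (positive p∈P)

    split-unique : Unique (zeros ++ positives ++ map -_ positives)
    split-unique = ++⁺ (filter⁺ (_≟ 0ℚ) {L} L-unique) (++⁺ P-unique (map⁺ ℚ.neg-injective P-unique) P-disjoint) Z-disjoint
      where
      P-unique = filter⁺ (0ℚ <?_) {L} L-unique
      P-disjoint : Disjoint positives (map -_ positives)
      P-disjoint (y∈P , y∈-P) = ℚ.<-asym (positive y∈P) (negative y∈-P)
      Z-disjoint : Disjoint zeros (positives ++ map -_ positives)
      Z-disjoint (y∈Z , y∈±P) with proj₂ (∈-filter⁻ (_≟ 0ℚ) {xs = L} y∈Z) | ∈-++⁻ positives y∈±P
      ... | refl | inj₁ y∈P  = ℚ.<-irrefl refl (positive y∈P)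
      ... | refl | inj₂ y∈-P = ℚ.<-irrefl refl (negative y∈-P)

    split-∈ : ∀ {y} → y ∈ L ⇔ y ∈ zeros ++ positives ++ map -_ positives
    split-∈ = mk⇔ to from
      where
      to : ∀ {y} → y ∈ L → y ∈ zeros ++ positives ++ map -_ positives
      to {y} y∈L with ℚ.<-cmp y 0ℚ
      ... | tri< y<0 _ _ = ∈-++⁺ʳ zeros (∈-++⁺ʳ positives (subst (_∈ map -_ positives) (neg-involutive y)
                             (∈-map⁺ -_ (∈-filter⁺ (0ℚ <?_) (closed y∈L) (ℚ.neg-antimono-< y<0)))))
      ... | tri≈ _ y≡0 _ = ∈-++⁺ˡ (∈-filter⁺ (_≟ 0ℚ) y∈L y≡0)
      ... | tri> _ _ y>0 = ∈-++⁺ʳ zeros (∈-++⁺ˡ (∈-filter⁺ (0ℚ <?_) y∈L y>0))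
      from : ∀ {y} → y ∈ zeros ++ positives ++ map -_ positives → y ∈ L
      from y∈ with ∈-++⁻ zeros y∈
      ... | inj₁ y∈Z = proj₁ (∈-filter⁻ (_≟ 0ℚ) {xs = L} y∈Z)
      ... | inj₂ y∈±P with ∈-++⁻ positives y∈±P
      ...   | inj₁ y∈P  = proj₁ (∈-filter⁻ (0ℚ <?_) {xs = L} y∈P)
      ...   | inj₂ y∈-P with ∈-map⁻ -_ y∈-P
      ...     | p , p∈P , refl = closed (proj₁ (∈-filter⁻ (0ℚ <?_) {xs = L} p∈P))

    split : L ↭ zeros ++ positives ++ map -_ positives
    split = ∼bag⇒↭ (unique∧set⇒bag L-unique split-unique split-∈)

    length-positives : length positives ℕ.+ length positives ℕ.≤ length L
    length-positives = begin
      length positives ℕ.+ length positives            ≡⟨ cong (length positives ℕ.+_) (length-map -_ positives) ⟨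
      length positives ℕ.+ length (map -_ positives)   ≡⟨ length-++ positives ⟨
      length (positives ++ map -_ positives)           ≤⟨ length-++-≤ʳ (positives ++ map -_ positives) {zeros} ⟩
      length (zeros ++ positives ++ map -_ positives)  ≡⟨ ↭-length split ⟨
      length L                                         ∎
      where open ℕ.≤-Reasoning

    sum-even : ∀ (g : ℚ → ℚ) → g 0ℚ ≡ 0ℚ → (∀ y → g (- y) ≡ g y) →
               sumℚ (map g L) ≡ sumℚ (map g positives) + sumℚ (map g positives)
    sum-even g g0≡0 g-even = begin
      sumℚ (map g L)                                                      ≡⟨ sumℚ-↭ (↭-map⁺ g split) ⟩
      sumℚ (map g (zeros ++ positives ++ map -_ positives))               ≡⟨ cong sumℚ map-split ⟩
      sumℚ (map g zeros ++ map g positives ++ map g (map -_ positives))   ≡⟨ sum-split ⟩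
      sumℚ (map g zeros) + (S + sumℚ (map g (map -_ positives)))
                                                                          ≡⟨ cong₂ (λ z s → z + (S + s)) sum-zeros sum-negatives ⟩
      0ℚ + (S + S)                                                        ≡⟨ ℚ.+-identityˡ (S + S) ⟩
      S + S                                                               ∎
      where
      open ≡-Reasoning
      S = sumℚ (map g positives)
      map-split = trans (map-++ g zeros _) (cong (map g zeros ++_) (map-++ g positives _))
      sum-split = trans (sumℚ-++ (map g zeros) _) (cong (sumℚ (map g zeros) +_) (sumℚ-++ (map g positives) _))
      sum-zeros : sumℚ (map g zeros) ≡ 0ℚ
      sum-zeros = sum-of-zeros (all-filter (_≟ 0ℚ) L)
        where
        sum-of-zeros : ∀ {zs} → All (_≡ 0ℚ) zs → sumℚ (map g zs) ≡ 0ℚ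
        sum-of-zeros []          = refl
        sum-of-zeros (refl ∷ zs) = trans (cong₂ _+_ g0≡0 (sum-of-zeros zs)) (ℚ.+-identityˡ 0ℚ)
      sum-negatives : sumℚ (map g (map -_ positives)) ≡ S
      sum-negatives = cong sumℚ (trans (sym (map-∘ positives)) (map-cong g-even positives))

  denominator-clears : ∀ y → 0ℚ ≤ y → y * fromℕ (↧ₙ y) ≡ fromℕ ℤ.∣ ↥ y ∣
  denominator-clears y@(mkℚ (ℤ.+ n) d _) _ =
    toℚᵘ-injective (ℚᵘ.≃-trans (toℚᵘ-homo-* y (fromℕ (suc d))) (ℚᵘ.*≡* cross))
    where
    cross : (ℤ.+ n ℤ.* ℤ.+ suc d) ℤ.* ℤ.+ 1 ≡ ℤ.+ n ℤ.* ℤ.+ (suc d ℕ.* 1)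
    cross = trans (ℤ.*-identityʳ _) (cong (λ k → ℤ.+ n ℤ.* ℤ.+ k) (sym (ℕ.*-identityʳ (suc d))))
  denominator-clears (mkℚ ℤ.-[1+ n ] d _) (*≤* ())

  common-denominator : ∀ ys → All (0ℚ ≤_) ys →
                       ∃[ D ] 0 ℕ.< D × ∃[ as ] length as ≡ length ys ×
                         (∀ k → sumℚ (map (_^ k) ys) * fromℕ (D ℕ.^ k) ≡ fromℕ (powerSum k as))
  common-denominator ys nonneg =
    D , ℕ.>-nonZero⁻¹ D , map numerator ys , length-map numerator ys ,
    λ k → trans (cong (sumℚ (map (_^ k) ys) *_) (fromℕ-^ D k)) (powerSum-scaling clears k)
    where
    D = product (map ↧ₙ_ ys)
    instance
      D≢0 : ℕ.NonZero D
      D≢0 = product≢0 (All.map⁺ (All.universal (λ _ → _) ys))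
    numerator : ℚ → ℕ
    numerator y = ℤ.∣ ↥ y ∣ ℕ.* (D ℕ./ ↧ₙ y)
    clears : All (λ y → y * fromℕ D ≡ fromℕ (numerator y)) ys
    clears = All.tabulate clear
      where
      clear : ∀ {y} → y ∈ ys → y * fromℕ D ≡ fromℕ (numerator y)
      clear {y} y∈ys = begin
        y * fromℕ D                   ≡⟨ cong (λ d → y * fromℕ d) ↧y*q≡D ⟨
        y * fromℕ (↧ₙ y ℕ.* q)        ≡⟨ cong (y *_) (fromℕ-* (↧ₙ y) q) ⟩
        y * (fromℕ (↧ₙ y) * fromℕ q)  ≡⟨ ℚ.*-assoc y (fromℕ (↧ₙ y)) (fromℕ q) ⟨
        y * fromℕ (↧ₙ y) * fromℕ q    ≡⟨ cong (_* fromℕ q) (denominator-clears y (All.lookup nonneg y∈ys)) ⟩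
        fromℕ ℤ.∣ ↥ y ∣ * fromℕ q     ≡⟨ fromℕ-* ℤ.∣ ↥ y ∣ q ⟨
        fromℕ (numerator y)           ∎
        where
        open ≡-Reasoning
        q = D ℕ./ ↧ₙ y
        ↧y*q≡D = m*[n/m]≡n (∈⇒∣product (∈-map⁺ ↧ₙ_ y∈ys))

  clear-denominators : ∀ {s c r e S} → s * fromℕ c ≡ fromℕ r → s * fromℕ e ≡ fromℕ S → c ℕ.* S ≡ r ℕ.* e
  clear-denominators {s} {c} {r} {e} {S} sc≡r se≡S = fromℕ-injective (begin
    fromℕ (c ℕ.* S)          ≡⟨ fromℕ-* c S ⟩
    fromℕ c * fromℕ S        ≡⟨ cong (fromℕ c *_) se≡S ⟨
    fromℕ c * (s * fromℕ e)  ≡⟨ x∙yz≈yx∙z (fromℕ c) s (fromℕ e) ⟩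
    s * fromℕ c * fromℕ e    ≡⟨ cong (_* fromℕ e) sc≡r ⟩
    fromℕ r * fromℕ e        ≡⟨ fromℕ-* r e ⟨
    fromℕ (r ℕ.* e)          ∎)
    where open ≡-Reasoning

  nonneg-solution⇒scaled-half-design :
    ∀ {N} P → length P ℕ.≤ N → All (0ℚ ≤_) P →
    sumℚ (map (_^ 2) P) * fromℕ 4 ≡ fromℕ (2 ℕ.* N) → sumℚ (map (_^ 4) P) * fromℕ 16 ≡ fromℕ (6 ℕ.* N) →
    ∃[ D ] 0 ℕ.< D × ∃[ as ] ScaledHalfDesign N D as
  nonneg-solution⇒scaled-half-design {N} P |P|≤N nonneg P-squares P-quartics with common-denominator P nonneg
  ... | D , D>0 , as , |as|≡|P| , scaled = D , D>0 , as , record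
    { length≤  = subst (ℕ._≤ N) (sym |as|≡|P|) |P|≤N
    ; squares  = ℕ.*-cancelˡ-≡ _ _ 2 (begin
        2 ℕ.* (2 ℕ.* powerSum 2 as)  ≡⟨ ℕ.*-assoc 2 2 (powerSum 2 as) ⟨
        4 ℕ.* powerSum 2 as          ≡⟨ clear-denominators {s = sumℚ (map (_^ 2) P)} {c = 4} P-squares (scaled 2) ⟩
        2 ℕ.* N ℕ.* D ℕ.^ 2          ≡⟨ ℕ.*-assoc 2 N (D ℕ.^ 2) ⟩
        2 ℕ.* (N ℕ.* D ℕ.^ 2)        ∎)
    ; quartics = ℕ.*-cancelˡ-≡ _ _ 2 (begin
        2 ℕ.* (8 ℕ.* powerSum 4 as)  ≡⟨ ℕ.*-assoc 2 8 (powerSum 4 as) ⟨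
        16 ℕ.* powerSum 4 as         ≡⟨ clear-denominators {s = sumℚ (map (_^ 4) P)} {c = 16} P-quartics (scaled 4) ⟩
        6 ℕ.* N ℕ.* D ℕ.^ 4          ≡⟨ regroup N (D ℕ.^ 4) ⟩
        2 ℕ.* (3 ℕ.* N ℕ.* D ℕ.^ 4)  ∎)
    }
    where
    open ≡-Reasoning
    regroup : ∀ n e → 6 ℕ.* n ℕ.* e ≡ 2 ℕ.* (3 ℕ.* n ℕ.* e)
    regroup = solve-∀

  antipodal-design⇒scaled-half-design : ∀ {N x} → IsChebDesign 5 (2 ℕ.* N) x → IsAntipodal x →
                                        ∃[ D ] 0 ℕ.< D × ∃[ as ] ScaledHalfDesign N D as
  antipodal-design⇒scaled-half-design {N} {x} design antipodal =
    nonneg-solution⇒scaled-half-design positives |P|≤N (All.map ℚ.<⇒≤ (all-filter (0ℚ <?_) L)) P-squares P-quartics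
    where
    L = tabulate x
    closed : ∀ {y} → y ∈ L → - y ∈ L
    closed y∈L with ∈-tabulate⁻ y∈L
    ... | i , refl with antipodal i
    ...   | j , xj≡-xi = subst (_∈ L) xj≡-xi (∈-tabulate⁺ j)
    open AntipodalSplit L (tabulate⁺ (proj₁ design)) closed
    moments = design-moments design (s≤s (s≤s (s≤s (s≤s z≤n))))
    |P|≤N : length positives ℕ.≤ N
    |P|≤N = ℕ.*-cancelˡ-≤ 2 (subst₂ ℕ._≤_ (cong (length positives ℕ.+_) (sym (ℕ.+-identityʳ _)))
                                          (length-tabulate x) length-positives)
    doubling : ∀ s c → s * (c + c) ≡ (s + s) * c
    doubling = solve 2 (λ s c → s :* (c :+ c) := (s :+ s) :* c) refl
    P-squares : sumℚ (map (_^ 2) positives) * fromℕ 4 ≡ fromℕ (2 ℕ.* N)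
    P-squares = begin
      S * fromℕ 4                 ≡⟨ doubling S (fromℕ 2) ⟩
      (S + S) * fromℕ 2           ≡⟨ cong (_* fromℕ 2) (sum-even (_^ 2) refl even) ⟨
      sumℚ (map (_^ 2) L) * fromℕ 2 ≡⟨ proj₁ moments ⟩
      fromℕ (2 ℕ.* N)             ∎
      where
      open ≡-Reasoning
      S = sumℚ (map (_^ 2) positives)
      even : ∀ y → (- y) ^ 2 ≡ y ^ 2
      even = solve 1 (λ y → (:- y) :^ 2 := y :^ 2) refl
    P-quartics : sumℚ (map (_^ 4) positives) * fromℕ 16 ≡ fromℕ (6 ℕ.* N)
    P-quartics = begin
      S * fromℕ 16                  ≡⟨ doubling S (fromℕ 8) ⟩
      (S + S) * fromℕ 8             ≡⟨ cong (_* fromℕ 8) (sum-even (_^ 4) refl even) ⟨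
      sumℚ (map (_^ 4) L) * fromℕ 8 ≡⟨ proj₂ moments ⟩
      fromℕ (3 ℕ.* (2 ℕ.* N))       ≡⟨ cong fromℕ (ℕ.*-assoc 3 2 N) ⟨
      fromℕ (6 ℕ.* N)               ∎
      where
      open ≡-Reasoning
      S = sumℚ (map (_^ 4) positives)
      even : ∀ y → (- y) ^ 4 ≡ y ^ 4
      even = solve 1 (λ y → (:- y) :^ 4 := y :^ 4) refl

open import Defs
open import Data.Nat using (ℕ; _*_)
open import Data.List using (_∷_; [])
open import Data.List.Membership.Propositional using (_∈_)
open import Data.List.Relation.Unary.All using (All; all?; lookup)
open import Data.Product using (_×_; _,_; ∃-syntax)
open import Relation.Nullary using (¬_)
open import Relation.Nullary.Decidable using (from-yes)
open Descent using (Admissible; admissible?; no-scaled-half-design)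
open Rational using (antipodal-design⇒scaled-half-design)

listed-admissible : All Admissible (1 ∷ 2 ∷ 4 ∷ 5 ∷ 7 ∷ 8 ∷ 10 ∷ 13 ∷ 16 ∷ [])
listed-admissible = from-yes (all? admissible? (1 ∷ 2 ∷ 4 ∷ 5 ∷ 7 ∷ 8 ∷ 10 ∷ 13 ∷ 16 ∷ []))

proposition6p2 : (N : ℕ) → N ∈ (1 ∷ 2 ∷ 4 ∷ 5 ∷ 7 ∷ 8 ∷ 10 ∷ 13 ∷ 16 ∷ []) →
    ¬ (∃[ x ] (IsChebDesign 5 (2 * N) x × IsAntipodal x))
proposition6p2 N N∈ (x , design , antipodal) =
  let D , D>0 , as , solution = antipodal-design⇒scaled-half-design {N} design antipodal
  in no-scaled-half-design (lookup listed-admissible N∈) D D>0 as solution
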